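{- Let $p\colon\mathbb{E}\to\mathbb{B}$ be a CLat$_\wedge$-fibration, $G\colon\mathbb{B}\to\mathbb{B}$ a functor, $\delta\colon S\to GS$ a $G$-coalgebra in $\mathbb{B}$, and $\dot G\colon\mathbb{E}\to\mathbb{E}$ a lifting of $G$ along $p$ such that each restriction $\dot G_X\colon\mathbb{E}_X\to\mathbb{E}_{GX}$ is $\omega^{\mathrm{op}}$-continuous. Let $\iota,\alpha\in\mathbb{E}_S$. Assume further that there is a monotone function $\neg\colon\mathbb{E}_S\to\mathbb{E}_S^{\mathrm{op}}$ with $\neg\circ\neg=\mathrm{id}$. Then $$\iota\le\nu x.\,(\alpha\wedge\delta^*\dot G_S x)\quad\text{if and only if}\quad \mu x.\,\bigl((\neg\alpha)\vee\neg(\delta^*\dot G_S(\neg x))\bigr)\le\neg\iota,$$ where the fixed points are taken in the complete lattice $\mathbb{E}_S$.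
   Context: A fibration $p\colon\mathbb{E}\to\mathbb{B}$ is a functor such that for each $Q\in\mathbb{E}$ and $l\colon X\to pQ$ in $\mathbb{B}$ there is a cartesian lifting $l^*Q\to Q$; the fibre $\mathbb{E}_X$ consists of objects over $X$ and morphisms over $\mathrm{id}_X$, and $l\colon X\to Y$ induces the reindexing (pullback) functor $l^*\colon\mathbb{E}_Y\to\mathbb{E}_X$. A CLat$_\wedge$-fibration is a fibration in which every fibre $\mathbb{E}_X$ is a complete lattice (a poset) and every reindexing $l^*$ preserves all meets. A lifting of $G$ along $p$ is a functor $\dot G\colon\mathbb{E}\to\mathbb{E}$ with $p\circ\dot G=G\circ p$; $\dot G_X\colon\mathbb{E}_X\to\mathbb{E}_{GX}$ is its restriction to fibres. $\mathbb{E}_S^{\mathrm{op}}$ is $\mathbb{E}_S$ with the reversed order (so $\neg$ is order-reversing). $\omega^{\mathrm{op}}$-continuous means preserving infima of decreasing $\omega$-chains. $\nu$, $\mu$ denote greatest and least fixed points. -}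

module Defs where

open import Level using (Level; _⊔_; Lift; lift) renaming (suc to lsuc)
open import Relation.Binary.PropositionalEquality using (_≡_; subst; subst₂; sym; trans; cong)
open import Data.Product using (Σ; Σ-syntax; _×_; _,_; proj₁; proj₂)
open import Data.Nat using (ℕ; suc)
open import Data.Bool using (Bool; true; false)

record Category (o h : Level) : Set (lsuc (o ⊔ h)) where
  infixr 9 _∘_
  field
    Obj : Set o
    Hom : Obj → Obj → Set h
    id  : ∀ {A} → Hom A A
    _∘_ : ∀ {A B C} → Hom B C → Hom A B → Hom A C
    identityˡ : ∀ {A B} (f : Hom A B) → id ∘ f ≡ f
    identityʳ : ∀ {A B} (f : Hom A B) → f ∘ id ≡ f
    assoc : ∀ {A B C D} (f : Hom C D) (g : Hom B C) (k : Hom A B) →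
            (f ∘ g) ∘ k ≡ f ∘ (g ∘ k)

record Functor {oC hC oD hD : Level} (C : Category oC hC) (D : Category oD hD)
       : Set (oC ⊔ hC ⊔ oD ⊔ hD) where
  private
    module C = Category C
    module D = Category D
  field
    F₀ : C.Obj → D.Obj
    F₁ : ∀ {A B} → C.Hom A B → D.Hom (F₀ A) (F₀ B)
    F-id : ∀ {A} → F₁ (C.id {A}) ≡ D.id
    F-∘ : ∀ {A B C'} (f : C.Hom B C') (g : C.Hom A B) →
          F₁ (f C.∘ g) ≡ F₁ f D.∘ F₁ g

module _ {oE hE oB hB : Level} {E : Category oE hE} {B : Category oB hB}
         (p : Functor E B) where
  private
    module E = Category E
    module B = Category B
    module p = Functor p

  IsCartesian : ∀ {P Q} → E.Hom P Q → Set (oE ⊔ hE ⊔ hB)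
  IsCartesian {P} {Q} f =
    ∀ {R} (g : E.Hom R Q) (k : B.Hom (p.F₀ R) (p.F₀ P)) →
    p.F₁ g ≡ p.F₁ f B.∘ k →
    Σ[ u ∈ E.Hom R P ] ((p.F₁ u ≡ k × f E.∘ u ≡ g) ×
                        (∀ (u' : E.Hom R P) → p.F₁ u' ≡ k → f E.∘ u' ≡ g → u' ≡ u))

  CartesianLift : (Q : E.Obj) {X : B.Obj} → B.Hom X (p.F₀ Q) → Set (oE ⊔ hE ⊔ oB ⊔ hB)
  CartesianLift Q {X} l =
    Σ[ P ∈ E.Obj ] Σ[ e ∈ p.F₀ P ≡ X ] Σ[ f ∈ E.Hom P Q ]
      (subst (λ Z → B.Hom Z (p.F₀ Q)) e (p.F₁ f) ≡ l × IsCartesian f)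

record Fibration {oE hE oB hB : Level} (E : Category oE hE) (B : Category oB hB)
       : Set (oE ⊔ hE ⊔ oB ⊔ hB) where
  field
    p    : Functor E B
    cartLift : (Q : Category.Obj E) {X : Category.Obj B} →
           (l : Category.Hom B X (Functor.F₀ p Q)) → CartesianLift p Q l

module Fib {oE hE oB hB : Level} {E : Category oE hE} {B : Category oB hB}
           (F : Fibration E B) where
  private
    module E = Category E
    module B = Category B
  open Fibration F
  private module p = Functor p

  FibObj : B.Obj → Set (oE ⊔ oB)
  FibObj X = Σ[ Q ∈ E.Obj ] (p.F₀ Q ≡ X)

  _≤_ : ∀ {X} → FibObj X → FibObj X → Set (hE ⊔ hB)
  a ≤ b = Σ[ f ∈ E.Hom (proj₁ a) (proj₁ b) ]
            (subst₂ B.Hom (proj₂ a) (proj₂ b) (p.F₁ f) ≡ B.id)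

  _≈_ : ∀ {X} → FibObj X → FibObj X → Set (hE ⊔ hB)
  a ≈ b = a ≤ b × b ≤ a

  reindex : ∀ {X Y} → B.Hom X Y → FibObj Y → FibObj X
  reindex {X} l a =
    let L = cartLift (proj₁ a) (subst (B.Hom X) (sym (proj₂ a)) l)
    in proj₁ L , proj₁ (proj₂ L)

  IsInf : ∀ {X} {ι : Level} {I : Set ι} → (I → FibObj X) → FibObj X →
          Set (oE ⊔ oB ⊔ hE ⊔ hB ⊔ ι)
  IsInf {X} {I = I} f m = (∀ i → m ≤ f i) × (∀ c → (∀ i → c ≤ f i) → c ≤ m)

  IsGFP : ∀ {X} → (FibObj X → FibObj X) → FibObj X → Set (oE ⊔ oB ⊔ hE ⊔ hB)
  IsGFP Φ z = Φ z ≈ z × (∀ y → Φ y ≈ y → y ≤ z)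

  IsLFP : ∀ {X} → (FibObj X → FibObj X) → FibObj X → Set (oE ⊔ oB ⊔ hE ⊔ hB)
  IsLFP Φ z = Φ z ≈ z × (∀ y → Φ y ≈ y → z ≤ y)

record CLatFibration {oE hE oB hB : Level} (E : Category oE hE) (B : Category oB hB)
       : Set (lsuc (oE ⊔ hE ⊔ oB ⊔ hB)) where
  field
    fibration : Fibration E B
  open Fib fibration
  field
    thin : ∀ {X} {a b : FibObj X} (f g : a ≤ b) → proj₁ f ≡ proj₁ g
    antisym : ∀ {X} {a b : FibObj X} → a ≤ b → b ≤ a → proj₁ a ≡ proj₁ b
    -- all meets (of families indexed by sets of the size of the fibre)
    meets : ∀ X (I : Set (oE ⊔ hE ⊔ oB ⊔ hB)) (f : I → FibObj X) →
            Σ[ m ∈ FibObj X ] IsInf f m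
    reindex-meets : ∀ {X Y} (l : Category.Hom B X Y)
                    (I : Set (oE ⊔ hE ⊔ oB ⊔ hB)) (f : I → FibObj Y) (m : FibObj Y) →
                    IsInf f m → IsInf (λ i → reindex l (f i)) (reindex l m)

module CLat {oE hE oB hB : Level} {E : Category oE hE} {B : Category oB hB}
            (P : CLatFibration E B) where
  open CLatFibration P
  open Fib fibration

  _∧_ : ∀ {X} → FibObj X → FibObj X → FibObj X
  _∧_ {X} a b = proj₁ (meets X (Lift (oE ⊔ hE ⊔ oB ⊔ hB) Bool) f)
    where
    f : Lift (oE ⊔ hE ⊔ oB ⊔ hB) Bool → FibObj X
    f (lift true)  = a
    f (lift false) = b

  _∨_ : ∀ {X} → FibObj X → FibObj X → FibObj X
  _∨_ {X} a b =
    proj₁ (meets X (Σ[ c ∈ FibObj X ] (a ≤ c × b ≤ c)) proj₁)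

record Lifting {oE hE oB hB : Level} {E : Category oE hE} {B : Category oB hB}
       (F : Fibration E B) (G : Functor B B) : Set (oE ⊔ hE ⊔ oB ⊔ hB) where
  private
    module p = Functor (Fibration.p F)
    module G = Functor G
  field
    Ġ : Functor E E
  private module Ġ = Functor Ġ
  field
    over₀ : ∀ Q → p.F₀ (Ġ.F₀ Q) ≡ G.F₀ (p.F₀ Q)
    over₁ : ∀ {Q Q'} (f : Category.Hom E Q Q') →
            subst₂ (Category.Hom B) (over₀ Q) (over₀ Q') (p.F₁ (Ġ.F₁ f)) ≡ G.F₁ (p.F₁ f)

  open Fib F

  restrict : ∀ X → FibObj X → FibObj (G.F₀ X)
  restrict X a = Ġ.F₀ (proj₁ a) , trans (over₀ (proj₁ a)) (cong G.F₀ (proj₂ a))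

  ωop-continuous : Set (oE ⊔ hE ⊔ oB ⊔ hB)
  ωop-continuous =
    ∀ X (c : ℕ → FibObj X) → (∀ n → c (suc n) ≤ c n) →
    ∀ m → IsInf c m → IsInf (λ n → restrict X (c n)) (restrict X m)

{-# OPTIONS --safe #-}
-- Negation is an order isomorphism between the fibre E_S and its opposite, and by
-- De Morgan it conjugates x ↦ α ∧ δ*Ġ_S x into x ↦ ¬α ∨ ¬(δ*Ġ_S(¬x)). Conjugation by an
-- order-reversing involution exchanges greatest and least fixed points, so μ = ¬ν, and
-- then ι ≤ ν holds iff ¬ν ≤ ¬ι, i.e. iff μ ≤ ¬ι.
module Submission where

open import Defs
open import Level using (Level; lift)
open import Data.Bool using (true; false)
open import Data.Product using (_,_; proj₁; proj₂)
open import Function.Bundles using (_⇔_; mk⇔)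
open import Relation.Binary.PropositionalEquality
  using (_≡_; refl; sym; trans; cong; subst; module ≡-Reasoning)
open import Axiom.UniquenessOfIdentityProofs.WithK using (uip)

module FibreLattice {oE hE oB hB : Level} {E : Category oE hE} {B : Category oB hB}
                    (P : CLatFibration E B) where
  open CLatFibration P
  open Fib fibration
  open CLat P
  private
    module E = Category E
    module p = Functor (Fibration.p fibration)

  ≤-refl : ∀ {X} (a : FibObj X) → a ≤ a
  ≤-refl (Q , refl) = E.id , p.F-id

  ≤-reflexive : ∀ {X} {a b : FibObj X} → a ≡ b → a ≤ b
  ≤-reflexive {a = a} refl = ≤-refl a

  ≤-antisym : ∀ {X} {a b : FibObj X} → a ≤ b → b ≤ a → a ≡ b
  ≤-antisym {a = Q , e} {b = _ , e'} a≤b b≤a with antisym a≤b b≤a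
  ... | refl = cong (Q ,_) (uip e e')

  ≈⇒≡ : ∀ {X} {a b : FibObj X} → a ≈ b → a ≡ b
  ≈⇒≡ (a≤b , b≤a) = ≤-antisym a≤b b≤a

  ≡⇒≈ : ∀ {X} {a b : FibObj X} → a ≡ b → a ≈ b
  ≡⇒≈ a≡b = ≤-reflexive a≡b , ≤-reflexive (sym a≡b)

  ∧-lowerˡ : ∀ {X} (a b : FibObj X) → (a ∧ b) ≤ a
  ∧-lowerˡ {X} a b = proj₁ (proj₂ (meets X _ _)) (lift true)

  ∧-lowerʳ : ∀ {X} (a b : FibObj X) → (a ∧ b) ≤ b
  ∧-lowerʳ {X} a b = proj₁ (proj₂ (meets X _ _)) (lift false)

  ∧-greatest : ∀ {X} {a b c : FibObj X} → c ≤ a → c ≤ b → c ≤ (a ∧ b)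
  ∧-greatest {X} c≤a c≤b = proj₂ (proj₂ (meets X _ _)) _
    λ { (lift true) → c≤a ; (lift false) → c≤b }

  ∨-least : ∀ {X} {a b c : FibObj X} → a ≤ c → b ≤ c → (a ∨ b) ≤ c
  ∨-least {X} {c = c} a≤c b≤c = proj₁ (proj₂ (meets X _ proj₁)) (c , a≤c , b≤c)

  ∨-greatest-lower : ∀ {X} {a b d : FibObj X} →
                     (∀ c → a ≤ c → b ≤ c → d ≤ c) → d ≤ (a ∨ b)
  ∨-greatest-lower {X} {d = d} below = proj₂ (proj₂ (meets X _ proj₁)) d
    λ { (c , a≤c , b≤c) → below c a≤c b≤c }

  lfp-unique : ∀ {X} {Ψ : FibObj X → FibObj X} {a b : FibObj X} →
               IsLFP Ψ a → IsLFP Ψ b → a ≡ b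
  lfp-unique (Ψa≈a , a-least) (Ψb≈b , b-least) =
    ≤-antisym (a-least _ Ψb≈b) (b-least _ Ψa≈a)

  module OrderReversingInvolution {X : Category.Obj B} (neg : FibObj X → FibObj X)
    (neg-antitone : ∀ a b → a ≤ b → neg b ≤ neg a)
    (neg-involutive≈ : ∀ a → neg (neg a) ≈ a) where

    neg-involutive : ∀ a → neg (neg a) ≡ a
    neg-involutive a = ≈⇒≡ (neg-involutive≈ a)

    neg-transposeˡ : ∀ {a c} → neg a ≤ c → neg c ≤ a
    neg-transposeˡ {a} {c} ¬a≤c = subst (neg c ≤_) (neg-involutive a) (neg-antitone _ _ ¬a≤c)

    neg-transposeʳ : ∀ {a c} → a ≤ neg c → c ≤ neg a
    neg-transposeʳ {a} {c} a≤¬c = subst (_≤ neg a) (neg-involutive c) (neg-antitone _ _ a≤¬c)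

    neg-antitone-⇔ : ∀ {a b} → a ≤ b ⇔ neg b ≤ neg a
    neg-antitone-⇔ {a} {b} = mk⇔ (neg-antitone a b) λ ¬b≤¬a →
      subst (a ≤_) (neg-involutive b) (neg-transposeʳ ¬b≤¬a)

    neg-∧ : ∀ a b → neg (a ∧ b) ≡ (neg a ∨ neg b)
    neg-∧ a b = ≤-antisym
      (∨-greatest-lower λ c ¬a≤c ¬b≤c →
        subst (neg (a ∧ b) ≤_) (neg-involutive c)
          (neg-antitone _ _ (∧-greatest (neg-transposeˡ ¬a≤c) (neg-transposeˡ ¬b≤c))))
      (∨-least (neg-antitone _ _ (∧-lowerˡ a b)) (neg-antitone _ _ (∧-lowerʳ a b)))

    gfp⇒lfp-conjugate : ∀ {Φ Ψ : FibObj X → FibObj X} {ν : FibObj X} →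
                        (∀ x → Ψ x ≡ neg (Φ (neg x))) → IsGFP Φ ν → IsLFP Ψ (neg ν)
    gfp⇒lfp-conjugate {Φ} {Ψ} {ν} Ψ≡¬Φ¬ (Φν≈ν , ν-greatest) = ≡⇒≈ Ψ¬ν≡¬ν , ¬ν-least
      where
      open ≡-Reasoning

      Ψ¬ν≡¬ν : Ψ (neg ν) ≡ neg ν
      Ψ¬ν≡¬ν = begin
        Ψ (neg ν)             ≡⟨ Ψ≡¬Φ¬ (neg ν) ⟩
        neg (Φ (neg (neg ν))) ≡⟨ cong (λ x → neg (Φ x)) (neg-involutive ν) ⟩
        neg (Φ ν)             ≡⟨ cong neg (≈⇒≡ Φν≈ν) ⟩
        neg ν                 ∎

      ¬ν-least : ∀ y → Ψ y ≈ y → neg ν ≤ y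
      ¬ν-least y Ψy≈y = neg-transposeˡ (ν-greatest (neg y) (≡⇒≈ Φ¬y≡¬y))
        where
        Φ¬y≡¬y : Φ (neg y) ≡ neg y
        Φ¬y≡¬y = begin
          Φ (neg y)             ≡⟨ sym (neg-involutive _) ⟩
          neg (neg (Φ (neg y))) ≡⟨ cong neg (sym (Ψ≡¬Φ¬ y)) ⟩
          neg (Ψ y)             ≡⟨ cong neg (≈⇒≡ Ψy≈y) ⟩
          neg y                 ∎

-- ω^op-continuity is what makes ν computable as a limit in the paper; the duality itself
-- does not need it.
proposition6 :
    ∀ {oE hE oB hB : Level} {E : Category oE hE} {B : Category oB hB}
      (P : CLatFibration E B) (G : Functor B B)
      (S : Category.Obj B) (δ : Category.Hom B S (Functor.F₀ G S))
      (L : Lifting (CLatFibration.fibration P) G) →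
      Lifting.ωop-continuous L →
      (ι α : Fib.FibObj (CLatFibration.fibration P) S) →
      (neg : Fib.FibObj (CLatFibration.fibration P) S → Fib.FibObj (CLatFibration.fibration P) S) →
      (∀ a b → Fib._≤_ (CLatFibration.fibration P) a b → Fib._≤_ (CLatFibration.fibration P) (neg b) (neg a)) →
      (∀ a → Fib._≈_ (CLatFibration.fibration P) (neg (neg a)) a) →
      (ν μ : Fib.FibObj (CLatFibration.fibration P) S) →
      Fib.IsGFP (CLatFibration.fibration P)
        (λ x → CLat._∧_ P α (Fib.reindex (CLatFibration.fibration P) δ (Lifting.restrict L S x))) ν →
      Fib.IsLFP (CLatFibration.fibration P)
        (λ x → CLat._∨_ P (neg α) (neg (Fib.reindex (CLatFibration.fibration P) δ (Lifting.restrict L S (neg x))))) μ →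
      (Fib._≤_ (CLatFibration.fibration P) ι ν ⇔ Fib._≤_ (CLatFibration.fibration P) μ (neg ι))
proposition6 P G S δ L _ ι α neg neg-antitone neg-involutive≈ ν μ ν-gfp μ-lfp =
  subst (λ m → ι ≤ ν ⇔ m ≤ neg ι) (sym μ≡¬ν) neg-antitone-⇔
  where
  open FibreLattice P
  open OrderReversingInvolution neg neg-antitone neg-involutive≈
  open Fib (CLatFibration.fibration P)

  step : FibObj S → FibObj S
  step x = reindex δ (Lifting.restrict L S x)

  μ≡¬ν : μ ≡ neg ν
  μ≡¬ν = lfp-unique μ-lfp (gfp⇒lfp-conjugate (λ x → sym (neg-∧ α (step (neg x)))) ν-gfp)
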